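{- Let $k\ge1$, $n\ge k+2$, $w=n-k-2$, and take an equation in $\mathcal{E}_{k+1,n}$ with associated frieze $(d_{i,j})$ and numbers $\alpha_i^j:=d_{i+1,w+i-j+1}$ ($i\in\mathbb{Z}$, $1\le j\le w$). Consider its Gale dual equation $W_i=\alpha_i^1W_{i-1}-\alpha_i^2W_{i-2}+\cdots+(-1)^{w-1}\alpha_i^wW_{i-w}+(-1)^wW_{i-w-1}$. Then (i) all solutions of the Gale dual equation satisfy $W_{i+n}=(-1)^wW_i$ (so the Gale dual equation lies in $\mathcal{E}_{w+1,n}$); (ii) the resulting map $\mathcal{E}_{k+1,n}\to\mathcal{E}_{w+1,n}$ is an involution, i.e. applying the same construction to the Gale dual equation returns the original equation.
   Context: For $m\ge0$, $\mathcal{E}_{m+1,n}$ is the set of difference equations $V_i=a_i^1V_{i-1}-a_i^2V_{i-2}+\cdots+(-1)^{m-1}a_i^mV_{i-m}+(-1)^mV_{i-m-1}$ ($i\in\mathbb{Z}$) with real coefficients $n$-periodic in $i$, such that every solution satisfies $V_{i+n}=(-1)^mV_i$. The frieze associated with an equation in $\mathcal{E}_{k+1,n}$ is the array $d_{i,j}:=V_j$ ($i\in\mathbb{Z}$, $i-k-1\le j\le i+w+k$), where $(V_s)$ is the solution with $V_{i-k-1}=\dots=V_{i-2}=0$, $V_{i-1}=1$. -}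

module Defs where

open import Level using (Level; _⊔_)
open import Algebra.Bundles using (CommutativeRing)
open import Data.Nat as ℕ using (ℕ; zero; suc)
open import Data.Integer as ℤ using (ℤ; +_)
open import Data.Product using (_×_; Σ)
open import Relation.Nullary using (¬_)

record Field (c ℓ : Level) : Set (Level.suc (c ⊔ ℓ)) where
  field
    commutativeRing : CommutativeRing c ℓ
  open CommutativeRing commutativeRing public
  field
    1≉0     : ¬ (1# ≈ 0#)
    inverse : ∀ x → ¬ (x ≈ 0#) → Σ Carrier (λ y → (x * y) ≈ 1#)

module _ {c ℓ : Level} (F : Field c ℓ) where
  open Field F

  sgn : ℕ → Carrier
  sgn zero    = 1#
  sgn (suc j) = - sgn j

  -- Coefficients a i j = a_i^j  (only 1 ≤ j ≤ m is used).
  Coeffs : Set c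
  Coeffs = ℤ → ℕ → Carrier

  partialSum : Coeffs → (ℤ → Carrier) → ℤ → ℕ → Carrier
  partialSum a V i zero    = 0#
  partialSum a V i (suc j) =
    partialSum a V i j + (sgn j * (a i (suc j) * V (i ℤ.- + suc j)))

  IsSolution : (m : ℕ) → Coeffs → (ℤ → Carrier) → Set ℓ
  IsSolution m a V =
    ∀ i → V i ≈ (partialSum a V i m + (sgn m * V (i ℤ.- + suc m)))

  Periodic : (m n : ℕ) → Coeffs → Set ℓ
  Periodic m n a = ∀ i j → 1 ℕ.≤ j → j ℕ.≤ m → a (i ℤ.+ + n) j ≈ a i j

  -- the equation with coefficients a lies in E_{m+1,n}
  InE : (m n : ℕ) → Coeffs → Set (c ⊔ ℓ)
  InE m n a =
    Periodic m n a ×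
    (∀ V → IsSolution m a V → ∀ i → V (i ℤ.+ + n) ≈ (sgn m * V i))

  -- d is the frieze of the equation (order k+1, coefficients a):
  -- for every i, j ↦ d i j is the solution with
  -- V_{i-k-1} = ... = V_{i-2} = 0, V_{i-1} = 1.
  -- (Such a solution exists and is unique, so d is determined on all of ℤ × ℤ;
  --  the paper only displays the range i-k-1 ≤ j ≤ i+w+k.)
  IsFrieze : (k : ℕ) → Coeffs → (ℤ → ℤ → Carrier) → Set ℓ
  IsFrieze k a d =
    ∀ i → IsSolution k a (d i)
        × (∀ t → 2 ℕ.≤ t → t ℕ.≤ suc k → d i (i ℤ.- + t) ≈ 0#)
        × d i (i ℤ.- + 1) ≈ 1#

  galeCoeffs : (w : ℕ) → (ℤ → ℤ → Carrier) → Coeffs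
  galeCoeffs w d i j = d (i ℤ.+ + 1) (((+ w ℤ.+ i) ℤ.- + j) ℤ.+ + 1)

-- Write n = k + w + 2.  Part (i): the coefficients α are n-periodic because the frieze is,
-- d_{i+n,j+n} = d_{i,j}, both rows solving the same equation with the same initial values.
-- For each t let R_t be the (-1)^w-antiperiodic sequence whose values at t, t-1, …, t-n+1 are
-- the coefficients 1, a^1, …, a^k, 1, 0, …, 0 of the equation at t-k-1.  The alternating sum,
-- over a window of length n, of R_t times a shifted row of the frieze changes sign when the
-- window moves by one step.  For the window ending at t this sum is the original equation,
-- hence zero; for the window ending at i it is the Gale dual equation at i.  So every R_t
-- solves the dual equation, and as R_t is 1 at t and 0 at t+1, …, t+w these solutions span
-- all solutions, which are therefore (-1)^w-antiperiodic.  Part (ii): by the same initial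
-- values the row e_{i+1} of the dual frieze is R_{i+k+1}, whose values are the a_i^j.

module Submission where

open import Defs
open import Level using (Level)
import Data.Nat as ℕ
open ℕ using (ℕ; zero; suc; z≤n; s≤s)
import Data.Nat.Properties as ℕP
open import Data.Nat.DivMod using (_/_; _%_; m<n⇒m/n≡0; m<n⇒m%n≡m; [m+n]%n≡m%n; m/n≡1+[m∸n]/n)
open import Data.Nat.Induction using (<-rec)
import Data.Integer as ℤ
open ℤ using (ℤ; +_; ∣_∣; 1ℤ)
import Data.Integer.Properties as ℤP
open import Data.Integer.Tactic.RingSolver using (solve-∀)
open import Data.Maybe using (nothing)
open import Data.Product using (_,_; _×_; proj₁; proj₂)
open import Data.Sum using (inj₁; inj₂)
open import Function.Base using (_∘_)
open import Function.Bundles using (_⇔_; mk⇔; Equivalence)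
open import Relation.Binary.Definitions using (tri<; tri≈; tri>)
open import Relation.Binary.PropositionalEquality as ≡ using (_≡_)
open import Relation.Nullary using (yes; no; contradiction)
import Tactic.RingSolver.Core.AlmostCommutativeRing as ACR

infixl 6 _+ℕ_ _-ℕ_

_+ℕ_ : ℤ → ℕ → ℤ
i +ℕ m = i ℤ.+ + m

_-ℕ_ : ℤ → ℕ → ℤ
i -ℕ m = i ℤ.- + m

-- Since + (m ℕ.+ n) reduces to + m ℤ.+ + n, index identities are instances of integer ring
-- identities, proved by solve-∀.
+ℕ-+ : ∀ i m n → i +ℕ (m ℕ.+ n) ≡ i +ℕ m +ℕ n
+ℕ-+ i m n = shape i (+ m) (+ n)
  where
  shape : ∀ i m n → i ℤ.+ (m ℤ.+ n) ≡ i ℤ.+ m ℤ.+ n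
  shape = solve-∀

+ℕ-cancel-ℕ : ∀ i m → i +ℕ m -ℕ m ≡ i
+ℕ-cancel-ℕ i m = shape i (+ m)
  where
  shape : ∀ i m → i ℤ.+ m ℤ.- m ≡ i
  shape = solve-∀

-ℕ-cancel+ℕ : ∀ i m → i -ℕ m +ℕ m ≡ i
-ℕ-cancel+ℕ i m = shape i (+ m)
  where
  shape : ∀ i m → i ℤ.- m ℤ.+ m ≡ i
  shape = solve-∀

+ℕ--ℕ-comm : ∀ i m n → i +ℕ m -ℕ n ≡ i -ℕ n +ℕ m
+ℕ--ℕ-comm i m n = shape i (+ m) (+ n)
  where
  shape : ∀ i m n → i ℤ.+ m ℤ.- n ≡ i ℤ.- n ℤ.+ m
  shape = solve-∀

+-∸ : ∀ {m n} → n ℕ.≤ m → + (m ℕ.∸ n) ≡ + m ℤ.- + n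
+-∸ {m} {n} n≤m = ≡.trans (≡.sym (ℤP.⊖-≥ n≤m)) (≡.sym (ℤP.m-n≡m⊖n m n))

+ℕ-∸ : ∀ i {m n} → n ℕ.≤ m → i +ℕ m -ℕ n ≡ i +ℕ (m ℕ.∸ n)
+ℕ-∸ i {m} {n} n≤m = ≡.trans (shape i (+ m) (+ n)) (≡.cong (λ x → i ℤ.+ x) (≡.sym (+-∸ n≤m)))
  where
  shape : ∀ i m n → i ℤ.+ m ℤ.- n ≡ i ℤ.+ (m ℤ.- n)
  shape = solve-∀

module Recurrences {c ℓ : Level} (F : Field c ℓ) where
  open Field F
  open import Algebra.Properties.Ring ring
    using ( -‿involutive; -‿distribˡ-*; -‿distribʳ-*; -0#≈0#; -‿+-comm; -1*x≈-x
          ; x∙y⁻¹≈ε⇒x≈y; x≈y⇒x∙y⁻¹≈ε )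
  open import Relation.Binary.Reasoning.Setoid setoid
  import Tactic.RingSolver.NonReflective (ACR.fromCommutativeRing commutativeRing (λ _ → nothing)) as Solver
  open Solver using (_⊕_; _⊗_; _⊜_)

  sgn-+ : ∀ m n → sgn F (m ℕ.+ n) ≈ sgn F m * sgn F n
  sgn-+ zero    n = sym (*-identityˡ _)
  sgn-+ (suc m) n = begin
    - sgn F (m ℕ.+ n)       ≈⟨ -‿cong (sgn-+ m n) ⟩
    - (sgn F m * sgn F n)   ≈⟨ -‿distribˡ-* _ _ ⟩
    - sgn F m * sgn F n     ∎

  sgn*sgn≈1 : ∀ m → sgn F m * sgn F m ≈ 1#
  sgn*sgn≈1 zero    = *-identityˡ 1#
  sgn*sgn≈1 (suc m) = begin
    - sgn F m * - sgn F m     ≈⟨ -‿distribˡ-* _ _ ⟨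
    - (sgn F m * - sgn F m)   ≈⟨ -‿cong (-‿distribʳ-* _ _) ⟨
    - - (sgn F m * sgn F m)   ≈⟨ -‿involutive _ ⟩
    sgn F m * sgn F m         ≈⟨ sgn*sgn≈1 m ⟩
    1#                        ∎

  sgn-cancelˡ : ∀ m x → sgn F m * (sgn F m * x) ≈ x
  sgn-cancelˡ m x = begin
    sgn F m * (sgn F m * x)   ≈⟨ *-assoc _ _ _ ⟨
    sgn F m * sgn F m * x     ≈⟨ *-congʳ (sgn*sgn≈1 m) ⟩
    1# * x                    ≈⟨ *-identityˡ x ⟩
    x                         ∎

  sgn-injective : ∀ m {x y} → sgn F m * x ≈ sgn F m * y → x ≈ y
  sgn-injective m {x} {y} eq = begin
    x                         ≈⟨ sgn-cancelˡ m x ⟨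
    sgn F m * (sgn F m * x)   ≈⟨ *-congˡ eq ⟩
    sgn F m * (sgn F m * y)   ≈⟨ sgn-cancelˡ m y ⟩
    y                         ∎

  ∑ : ℕ → (ℕ → Carrier) → Carrier
  ∑ zero    f = 0#
  ∑ (suc N) f = ∑ N f + f N

  syntax ∑ N (λ y → e) = ∑[ y < N ] e

  ∑-cong : ∀ N {f g} → (∀ y → y ℕ.< N → f y ≈ g y) → ∑ N f ≈ ∑ N g
  ∑-cong zero    f≈g = refl
  ∑-cong (suc N) f≈g = +-cong (∑-cong N (λ y y<N → f≈g y (ℕP.m<n⇒m<1+n y<N))) (f≈g N ℕP.≤-refl)

  ∑-≈0 : ∀ N {f} → (∀ y → y ℕ.< N → f y ≈ 0#) → ∑ N f ≈ 0#
  ∑-≈0 zero    f≈0 = refl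
  ∑-≈0 (suc N) f≈0 = begin
    ∑ N _ + _   ≈⟨ +-cong (∑-≈0 N (λ y y<N → f≈0 y (ℕP.m<n⇒m<1+n y<N))) (f≈0 N ℕP.≤-refl) ⟩
    0# + 0#     ≈⟨ +-identityˡ 0# ⟩
    0#          ∎

  ∑-+ : ∀ M N f → ∑ (M ℕ.+ N) f ≈ ∑ M f + ∑[ y < N ] f (M ℕ.+ y)
  ∑-+ M zero    f = begin
    ∑ (M ℕ.+ 0) f   ≡⟨ ≡.cong (λ x → ∑ x f) (ℕP.+-identityʳ M) ⟩
    ∑ M f           ≈⟨ +-identityʳ _ ⟨
    ∑ M f + 0#      ∎
  ∑-+ M (suc N) f = begin
    ∑ (M ℕ.+ suc N) f                                     ≡⟨ ≡.cong (λ x → ∑ x f) (ℕP.+-suc M N) ⟩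
    ∑ (M ℕ.+ N) f + f (M ℕ.+ N)                           ≈⟨ +-congʳ (∑-+ M N f) ⟩
    ∑ M f + ∑[ y < N ] f (M ℕ.+ y) + f (M ℕ.+ N)          ≈⟨ +-assoc _ _ _ ⟩
    ∑ M f + (∑[ y < N ] f (M ℕ.+ y) + f (M ℕ.+ N))        ∎

  ∑-head : ∀ N f → ∑ (suc N) f ≈ f 0 + ∑[ y < N ] f (suc y)
  ∑-head N f = trans (∑-+ 1 N f) (+-congʳ (+-identityˡ (f 0)))

  ∑-neg : ∀ N f → ∑[ y < N ] (- f y) ≈ - ∑ N f
  ∑-neg zero    f = sym -0#≈0#
  ∑-neg (suc N) f = trans (+-congʳ (∑-neg N f)) (-‿+-comm _ _)

  -- Linear recurrences

  SolutionAt : ℕ → Coeffs F → (ℤ → Carrier) → ℤ → Set ℓ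
  SolutionAt m a V i = V i ≈ partialSum F a V i m + sgn F m * V (i -ℕ suc m)

  IsSolutionFrom : ℕ → Coeffs F → (ℤ → Carrier) → ℤ → Set ℓ
  IsSolutionFrom m a V p = ∀ y → SolutionAt m a V (p +ℕ y)

  partialSum-∑ : ∀ a V i j → partialSum F a V i j ≡ ∑[ y < j ] (sgn F y * (a i (suc y) * V (i -ℕ suc y)))
  partialSum-∑ a V i zero    = ≡.refl
  partialSum-∑ a V i (suc j) = ≡.cong (_+ sgn F j * (a i (suc j) * V (i -ℕ suc j))) (partialSum-∑ a V i j)

  partialSum-linear : ∀ a V U q i j →
    partialSum F a (λ u → V u + q * U u) i j ≈ partialSum F a V i j + q * partialSum F a U i j
  partialSum-linear a V U q i zero    = sym (trans (+-congˡ (zeroʳ q)) (+-identityʳ 0#))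
  partialSum-linear a V U q i (suc j) = trans (+-congʳ (partialSum-linear a V U q i j)) (regroup _ _ _ _ _ _ _)
    where
    regroup : ∀ P Q q s x v u → P + q * Q + s * (x * (v + q * u)) ≈ P + s * (x * v) + q * (Q + s * (x * u))
    regroup = Solver.solve 7 (λ P Q q s x v u →
      ((P ⊕ (q ⊗ Q)) ⊕ (s ⊗ (x ⊗ (v ⊕ (q ⊗ u)))))
        ⊜ ((P ⊕ (s ⊗ (x ⊗ v))) ⊕ (q ⊗ (Q ⊕ (s ⊗ (x ⊗ u)))))) refl

  SolutionAt-linear : ∀ m a V U q i → SolutionAt m a V i → SolutionAt m a U i →
                      SolutionAt m a (λ u → V u + q * U u) i
  SolutionAt-linear m a V U q i solV solU = begin
    V i + q * U i                                                   ≈⟨ +-cong solV (*-congˡ solU) ⟩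
    (ps V + sgn F m * V i') + q * (ps U + sgn F m * U i')          ≈⟨ regroup _ _ _ _ _ _ ⟩
    (ps V + q * ps U) + sgn F m * (V i' + q * U i')                 ≈⟨ +-congʳ (partialSum-linear a V U q i m) ⟨
    partialSum F a (λ u → V u + q * U u) i m + sgn F m * (V i' + q * U i') ∎
    where
    ps = λ W → partialSum F a W i m
    i' = i -ℕ suc m
    regroup : ∀ P Q q s v u → (P + s * v) + q * (Q + s * u) ≈ (P + q * Q) + s * (v + q * u)
    regroup = Solver.solve 6 (λ P Q q s v u →
      (((P ⊕ (s ⊗ v)) ⊕ (q ⊗ (Q ⊕ (s ⊗ u)))) ⊜ ((P ⊕ (q ⊗ Q)) ⊕ (s ⊗ (v ⊕ (q ⊗ u)))))) refl

  partialSum-≈0 : ∀ a V i j → (∀ y → 1 ℕ.≤ y → y ℕ.≤ j → V (i -ℕ y) ≈ 0#) →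
                  partialSum F a V i j ≈ 0#
  partialSum-≈0 a V i j V≈0 = begin
    partialSum F a V i j                                      ≡⟨ partialSum-∑ a V i j ⟩
    ∑[ y < j ] (sgn F y * (a i (suc y) * V (i -ℕ suc y)))     ≈⟨ ∑-≈0 j term≈0 ⟩
    0#                                                        ∎
    where
    term≈0 : ∀ y → y ℕ.< j → sgn F y * (a i (suc y) * V (i -ℕ suc y)) ≈ 0#
    term≈0 y y<j = trans (*-congˡ (trans (*-congˡ (V≈0 (suc y) (s≤s z≤n) y<j)) (zeroʳ _))) (zeroʳ _)

  SolutionAt-last : ∀ m a V i → SolutionAt m a V i → (∀ y → 1 ℕ.≤ y → y ℕ.≤ m → V (i -ℕ y) ≈ 0#) →
                    V i ≈ sgn F m * V (i -ℕ suc m)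
  SolutionAt-last m a V i sol V≈0 = trans sol (trans (+-congʳ (partialSum-≈0 a V i m V≈0)) (+-identityˡ _))

  SolutionAt-vanish : ∀ m a V i → SolutionAt m a V i →
                      (∀ y → 1 ℕ.≤ y → y ℕ.≤ suc m → V (i -ℕ y) ≈ 0#) → V i ≈ 0#
  SolutionAt-vanish m a V i sol V≈0 = begin
    V i                         ≈⟨ SolutionAt-last m a V i sol (λ y 1≤y → V≈0 y 1≤y ∘ ℕP.m≤n⇒m≤1+n) ⟩
    sgn F m * V (i -ℕ suc m)    ≈⟨ *-congˡ (V≈0 (suc m) (s≤s z≤n) ℕP.≤-refl) ⟩
    sgn F m * 0#                ≈⟨ zeroʳ _ ⟩
    0#                          ∎

  IsSolutionFrom-vanish : ∀ m a V p → IsSolutionFrom m a V (p +ℕ suc m) →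
                          (∀ y → y ℕ.≤ m → V (p +ℕ y) ≈ 0#) → ∀ y → V (p +ℕ y) ≈ 0#
  IsSolutionFrom-vanish m a V p sol V≈0 = <-rec _ step
    where
    step : ∀ y → (∀ {x} → x ℕ.< y → V (p +ℕ x) ≈ 0#) → V (p +ℕ y) ≈ 0#
    step y earlier with y ℕP.≤? m
    ... | yes y≤m = V≈0 y y≤m
    ... | no  y≰m = SolutionAt-vanish m a V (p +ℕ y) solAt window
      where
      m<y = ℕP.≰⇒> y≰m
      solAt : SolutionAt m a V (p +ℕ y)
      solAt = ≡.subst (SolutionAt m a V)
        (≡.trans (≡.sym (+ℕ-+ p (suc m) _)) (≡.cong (p +ℕ_) (ℕP.m+[n∸m]≡n m<y)))
        (sol (y ℕ.∸ suc m))
      window : ∀ x → 1 ℕ.≤ x → x ℕ.≤ suc m → V (p +ℕ y -ℕ x) ≈ 0#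
      window x 1≤x x≤1+m = trans (reflexive (≡.cong V (+ℕ-∸ p x≤y)))
                                 (earlier (ℕP.∸-monoʳ-< 1≤x x≤y))
        where x≤y = ℕP.≤-trans x≤1+m m<y

  x-y-z≈0⇔x≈y+z : ∀ x y z → (x - y - z ≈ 0#) ⇔ (x ≈ y + z)
  x-y-z≈0⇔x≈y+z x y z = mk⇔
    (λ eq → x∙y⁻¹≈ε⇒x≈y x (y + z) (trans (sym reassoc) eq))
    (λ eq → trans reassoc (x≈y⇒x∙y⁻¹≈ε eq))
    where
    reassoc : x - y - z ≈ x - (y + z)
    reassoc = trans (+-assoc x (- y) (- z)) (+-congˡ (-‿+-comm y z))

  alternatingSum-residual : ∀ m a X i (c : ℕ → Carrier) → c 0 ≈ 1# → c (suc m) ≈ 1# →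
    (∀ y → 1 ℕ.≤ y → y ℕ.≤ m → c y ≈ a i y) →
    ∑[ y < suc (suc m) ] (sgn F y * (c y * X (i -ℕ y))) ≈ X i - partialSum F a X i m - sgn F m * X (i -ℕ suc m)
  alternatingSum-residual m a X i c c₀≈1 cₘ≈1 c≈a = begin
    ∑ (suc (suc m)) f                                   ≈⟨ ∑-head (suc m) f ⟩
    f 0 + (∑[ y < m ] f (suc y) + f (suc m))            ≈⟨ +-cong first (+-cong middle last) ⟩
    X i + (- partialSum F a X i m + - L)                ≈⟨ +-assoc _ _ _ ⟨
    X i - partialSum F a X i m - L                      ∎
    where
    f = λ y → sgn F y * (c y * X (i -ℕ y))
    L = sgn F m * X (i -ℕ suc m)
    first : f 0 ≈ X i
    first = trans (*-identityˡ _) (trans (*-cong c₀≈1 (reflexive (≡.cong X (ℤP.+-identityʳ i)))) (*-identityˡ _))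
    middle : ∑[ y < m ] f (suc y) ≈ - partialSum F a X i m
    middle = begin
      ∑[ y < m ] f (suc y)                                          ≈⟨ ∑-cong m (λ y y<m →
        trans (sym (-‿distribˡ-* _ _)) (-‿cong (*-congˡ (*-congʳ (c≈a (suc y) (s≤s z≤n) y<m))))) ⟩
      ∑[ y < m ] (- (sgn F y * (a i (suc y) * X (i -ℕ suc y))))     ≈⟨ ∑-neg m _ ⟩
      - ∑[ y < m ] (sgn F y * (a i (suc y) * X (i -ℕ suc y)))       ≡⟨ ≡.cong -_ (partialSum-∑ a X i m) ⟨
      - partialSum F a X i m                                        ∎
    last : f (suc m) ≈ - L
    last = trans (sym (-‿distribˡ-* _ _)) (-‿cong (*-congˡ (trans (*-congʳ cₘ≈1) (*-identityˡ _))))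

  SolutionAt⇔alternatingSum≈0 : ∀ m a X i (c : ℕ → Carrier) → c 0 ≈ 1# → c (suc m) ≈ 1# →
    (∀ y → 1 ℕ.≤ y → y ℕ.≤ m → c y ≈ a i y) →
    SolutionAt m a X i ⇔ (∑[ y < suc (suc m) ] (sgn F y * (c y * X (i -ℕ y))) ≈ 0#)
  SolutionAt⇔alternatingSum≈0 m a X i c c₀≈1 cₘ≈1 c≈a = mk⇔
    (λ sol → trans residual (Equivalence.from (x-y-z≈0⇔x≈y+z _ _ _) sol))
    (λ ∑≈0 → Equivalence.to (x-y-z≈0⇔x≈y+z _ _ _) (trans (sym residual) ∑≈0))
    where residual = alternatingSum-residual m a X i c c₀≈1 cₘ≈1 c≈a

  SolutionAt-translate : ∀ m n a V j → Periodic F m n a → SolutionAt m a V (j +ℕ n) →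
                         SolutionAt m a (λ u → V (u +ℕ n)) j
  SolutionAt-translate m n a V j per sol =
    trans sol (+-cong sums (*-congˡ (reflexive (≡.cong V (+ℕ--ℕ-comm j n (suc m))))))
    where
    sums : partialSum F a V (j +ℕ n) m ≈ partialSum F a (λ u → V (u +ℕ n)) j m
    sums = begin
      partialSum F a V (j +ℕ n) m                                       ≡⟨ partialSum-∑ a V (j +ℕ n) m ⟩
      ∑[ y < m ] (sgn F y * (a (j +ℕ n) (suc y) * V (j +ℕ n -ℕ suc y)))  ≈⟨ ∑-cong m (λ y y<m → *-congˡ (*-cong
        (per j (suc y) (s≤s z≤n) y<m) (reflexive (≡.cong V (+ℕ--ℕ-comm j n (suc y)))))) ⟩
      ∑[ y < m ] (sgn F y * (a j (suc y) * V (j -ℕ suc y +ℕ n)))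
        ≡⟨ partialSum-∑ a (λ u → V (u +ℕ n)) j m ⟨
      partialSum F a (λ u → V (u +ℕ n)) j m                             ∎

  antiperiodicExtension : ℕ → (n : ℕ) → .{{ℕ.NonZero n}} → (ℕ → Carrier) → ℕ → Carrier
  antiperiodicExtension e n f y = sgn F (e ℕ.* (y / n)) * f (y % n)

  antiperiodicExtension-< : ∀ e n .{{_ : ℕ.NonZero n}} f {y} → y ℕ.< n → antiperiodicExtension e n f y ≈ f y
  antiperiodicExtension-< e n f {y} y<n = begin
    sgn F (e ℕ.* (y / n)) * f (y % n)
      ≡⟨ ≡.cong₂ (λ q r → sgn F (e ℕ.* q) * f r) (m<n⇒m/n≡0 y<n) (m<n⇒m%n≡m y<n) ⟩
    sgn F (e ℕ.* 0) * f y               ≡⟨ ≡.cong (λ x → sgn F x * f y) (ℕP.*-zeroʳ e) ⟩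
    1# * f y                            ≈⟨ *-identityˡ _ ⟩
    f y                                 ∎

  antiperiodicExtension-+ : ∀ e n .{{_ : ℕ.NonZero n}} f y →
    antiperiodicExtension e n f (y ℕ.+ n) ≈ sgn F e * antiperiodicExtension e n f y
  antiperiodicExtension-+ e n f y = begin
    sgn F (e ℕ.* ((y ℕ.+ n) / n)) * f ((y ℕ.+ n) % n)
      ≡⟨ ≡.cong₂ (λ q r → sgn F (e ℕ.* q) * f r) quotient ([m+n]%n≡m%n y n) ⟩
    sgn F (e ℕ.* suc (y / n)) * f (y % n)
      ≡⟨ ≡.cong (λ x → sgn F x * f (y % n)) (ℕP.*-suc e (y / n)) ⟩
    sgn F (e ℕ.+ e ℕ.* (y / n)) * f (y % n)             ≈⟨ *-congʳ (sgn-+ e _) ⟩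
    sgn F e * sgn F (e ℕ.* (y / n)) * f (y % n)         ≈⟨ *-assoc _ _ _ ⟩
    sgn F e * (sgn F (e ℕ.* (y / n)) * f (y % n))       ∎
    where
    quotient : (y ℕ.+ n) / n ≡ suc (y / n)
    quotient = ≡.trans (m/n≡1+[m∸n]/n (ℕP.m≤n+m n y)) (≡.cong (λ x → suc (x / n)) (ℕP.m+n∸n≡m y n))

  windowSum : ℕ → (ℤ → Carrier) → ℤ → Carrier
  windowSum N Q j = ∑[ y < N ] (sgn F y * Q (j -ℕ y))

  windowSum-step : ∀ n' Q p → Q (p +ℕ suc n') ≈ sgn F (suc n') * Q p →
                   windowSum (suc n') Q (p +ℕ suc n') ≈ - windowSum (suc n') Q (p +ℕ n')
  windowSum-step n' Q p antiperiodic = begin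
    windowSum (suc n') Q (p +ℕ suc n')                                  ≈⟨ ∑-head n' _ ⟩
    1# * Q (p +ℕ suc n' -ℕ 0) + ∑[ y < n' ] (sgn F (suc y) * Q (p +ℕ suc n' -ℕ suc y))
                                                                        ≈⟨ +-cong newest (∑-cong n' shifted) ⟩
    - (sgn F n' * Q p) + ∑[ y < n' ] (- (sgn F y * Q (p +ℕ n' -ℕ y)))   ≈⟨ +-congˡ (∑-neg n' _) ⟩
    - (sgn F n' * Q p) + - older                                        ≈⟨ -‿+-comm _ _ ⟩
    - (sgn F n' * Q p + older)                                          ≈⟨ -‿cong (+-comm _ _) ⟩
    - (older + sgn F n' * Q p)
      ≡⟨ ≡.cong (λ u → - (older + sgn F n' * Q u)) (+ℕ-cancel-ℕ p n') ⟨
    - windowSum (suc n') Q (p +ℕ n')                                    ∎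
    where
    older = ∑[ y < n' ] (sgn F y * Q (p +ℕ n' -ℕ y))
    shape : ∀ p n y → p ℤ.+ (1ℤ ℤ.+ n) ℤ.- (1ℤ ℤ.+ y) ≡ p ℤ.+ n ℤ.- y
    shape = solve-∀
    shifted : ∀ y → y ℕ.< n' → sgn F (suc y) * Q (p +ℕ suc n' -ℕ suc y) ≈ - (sgn F y * Q (p +ℕ n' -ℕ y))
    shifted y _ = trans (sym (-‿distribˡ-* _ _)) (-‿cong (*-congˡ (reflexive (≡.cong Q (shape p (+ n') (+ y))))))
    newest : 1# * Q (p +ℕ suc n' -ℕ 0) ≈ - (sgn F n' * Q p)
    newest = begin
      1# * Q (p +ℕ suc n' -ℕ 0)     ≈⟨ *-identityˡ _ ⟩
      Q (p +ℕ suc n' -ℕ 0)          ≡⟨ ≡.cong Q (ℤP.+-identityʳ _) ⟩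
      Q (p +ℕ suc n')               ≈⟨ antiperiodic ⟩
      - sgn F n' * Q p              ≈⟨ -‿distribˡ-* _ _ ⟨
      - (sgn F n' * Q p)            ∎

  alternating-≈0 : ∀ (f : ℕ → Carrier) → (∀ y → f (suc y) ≈ - f y) →
                   ∀ m → f m ≈ 0# → ∀ y → f y ≈ 0#
  alternating-≈0 f flip m fₘ≈0 = upward
    where
    -x≈0⇒x≈0 : ∀ {x} → - x ≈ 0# → x ≈ 0#
    -x≈0⇒x≈0 {x} -x≈0 = trans (sym (-‿involutive x)) (trans (-‿cong -x≈0) -0#≈0#)
    downward : ∀ m → f m ≈ 0# → f 0 ≈ 0#
    downward zero    f₀≈0 = f₀≈0
    downward (suc m) fₘ≈0 = downward m (-x≈0⇒x≈0 (trans (sym (flip m)) fₘ≈0))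
    upward : ∀ y → f y ≈ 0#
    upward zero    = downward m fₘ≈0
    upward (suc y) = trans (flip y) (trans (-‿cong (upward y)) -0#≈0#)

  IsSolutionFrom-agree : ∀ m a V U p → IsSolutionFrom m a V (p +ℕ suc m) → IsSolutionFrom m a U (p +ℕ suc m) →
    (∀ y → y ℕ.≤ m → V (p +ℕ y) ≈ U (p +ℕ y)) → ∀ y → V (p +ℕ y) ≈ U (p +ℕ y)
  IsSolutionFrom-agree m a V U p solV solU V≈U y = x-y≈0⇒x≈y (IsSolutionFrom-vanish m a difference p
    (λ N → SolutionAt-linear m a V U (- 1#) _ (solV N) (solU N)) (λ y y≤m → x≈y⇒x-y≈0 (V≈U y y≤m)) y)
    where
    difference = λ u → V u + - 1# * U u
    x-y≈0⇒x≈y : ∀ {x y} → x + - 1# * y ≈ 0# → x ≈ y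
    x-y≈0⇒x≈y {x} {y} eq = x∙y⁻¹≈ε⇒x≈y x y (trans (+-congˡ (sym (-1*x≈-x y))) eq)
    x≈y⇒x-y≈0 : ∀ {x y} → x ≈ y → x + - 1# * y ≈ 0#
    x≈y⇒x-y≈0 {x} {y} eq = trans (+-congˡ (-1*x≈-x y)) (x≈y⇒x∙y⁻¹≈ε eq)

  -- Gale duality

  module GaleDuality (k w : ℕ) (a : Coeffs F) (a∈E : InE F k (2 ℕ.+ (k ℕ.+ w)) a)
                     (d : ℤ → ℤ → Carrier) (d-frieze : IsFrieze F k a d) where

    n' n : ℕ
    n' = suc (k ℕ.+ w)
    n  = suc n'

    α : Coeffs F
    α = galeCoeffs F w d

    d-solution : ∀ i → IsSolution F k a (d i)
    d-solution i = proj₁ (d-frieze i)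

    d-initial-zero : ∀ i τ → 2 ℕ.≤ τ → τ ℕ.≤ suc k → d i (i -ℕ τ) ≈ 0#
    d-initial-zero i = proj₁ (proj₂ (d-frieze i))

    d-initial-one : ∀ i → d i (i -ℕ 1) ≈ 1#
    d-initial-one i = proj₂ (proj₂ (d-frieze i))

    d-antiperiodic : ∀ i u → d i (u +ℕ n) ≈ sgn F k * d i u
    d-antiperiodic i = proj₂ a∈E (d i) (d-solution i)

    d-diagonal : ∀ i → d i (i +ℕ w) ≈ 1#
    d-diagonal i = sgn-injective k (begin
      sgn F k * d i (i +ℕ w)              ≡⟨ ≡.cong (λ u → sgn F k * d i u) (shape₁ i (+ k) (+ w)) ⟨
      sgn F k * d i (s -ℕ suc k)          ≈⟨ SolutionAt-last k a (d i) s (d-solution i s) earlier≈0 ⟨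
      d i s                               ≡⟨ ≡.cong (d i) (shape₂ i (+ k ℤ.+ + w)) ⟩
      d i (i -ℕ 1 +ℕ n)                   ≈⟨ d-antiperiodic i _ ⟩
      sgn F k * d i (i -ℕ 1)              ≈⟨ *-congˡ (d-initial-one i) ⟩
      sgn F k * 1#                        ∎)
      where
      s = i +ℕ n'
      shape₁ : ∀ i k w → i ℤ.+ (1ℤ ℤ.+ (k ℤ.+ w)) ℤ.- (1ℤ ℤ.+ k) ≡ i ℤ.+ w
      shape₁ = solve-∀
      shape₂ : ∀ i m → i ℤ.+ (1ℤ ℤ.+ m) ≡ i ℤ.- 1ℤ ℤ.+ (1ℤ ℤ.+ (1ℤ ℤ.+ m))
      shape₂ = solve-∀
      shape₃ : ∀ i m y → i ℤ.+ (1ℤ ℤ.+ m) ℤ.- y ≡ i ℤ.- (1ℤ ℤ.+ y) ℤ.+ (1ℤ ℤ.+ (1ℤ ℤ.+ m))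
      shape₃ = solve-∀
      earlier≈0 : ∀ y → 1 ℕ.≤ y → y ℕ.≤ k → d i (s -ℕ y) ≈ 0#
      earlier≈0 y 1≤y y≤k = begin
        d i (s -ℕ y)                ≡⟨ ≡.cong (d i) (shape₃ i (+ k ℤ.+ + w) (+ y)) ⟩
        d i (i -ℕ suc y +ℕ n)       ≈⟨ d-antiperiodic i _ ⟩
        sgn F k * d i (i -ℕ suc y)  ≈⟨ *-congˡ (d-initial-zero i (suc y) (s≤s 1≤y) (s≤s y≤k)) ⟩
        sgn F k * 0#                ≈⟨ zeroʳ _ ⟩
        0#                          ∎

    d-initial-periodic : ∀ i τ → 1 ℕ.≤ τ → τ ℕ.≤ suc k → d (i +ℕ n) (i +ℕ n -ℕ τ) ≈ d i (i -ℕ τ)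
    d-initial-periodic i (suc zero)    _ _   = trans (d-initial-one _) (sym (d-initial-one i))
    d-initial-periodic i (suc (suc τ)) _ τ≤k =
      trans (d-initial-zero _ _ (s≤s (s≤s z≤n)) τ≤k) (sym (d-initial-zero i _ (s≤s (s≤s z≤n)) τ≤k))

    d-periodic : ∀ i y → d (i +ℕ n) (i -ℕ suc k +ℕ y +ℕ n) ≈ d i (i -ℕ suc k +ℕ y)
    d-periodic i = IsSolutionFrom-agree k a (λ u → d (i +ℕ n) (u +ℕ n)) (d i) (i -ℕ suc k)
      (λ _ → SolutionAt-translate k n a (d (i +ℕ n)) _ (proj₁ a∈E) (d-solution (i +ℕ n) _))
      (λ _ → d-solution i _)
      initial
      where
      shape : ∀ i m y → i ℤ.- m ℤ.+ y ≡ i ℤ.- (m ℤ.- y)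
      shape = solve-∀
      initial : ∀ y → y ℕ.≤ k → d (i +ℕ n) (i -ℕ suc k +ℕ y +ℕ n) ≈ d i (i -ℕ suc k +ℕ y)
      initial y y≤k = begin
        d (i +ℕ n) (i -ℕ suc k +ℕ y +ℕ n)   ≡⟨ ≡.cong (λ u → d (i +ℕ n) (u +ℕ n)) before ⟩
        d (i +ℕ n) (i -ℕ τ +ℕ n)            ≡⟨ ≡.cong (d (i +ℕ n)) (+ℕ--ℕ-comm i n τ) ⟨
        d (i +ℕ n) (i +ℕ n -ℕ τ)            ≈⟨ d-initial-periodic i τ 1≤τ (ℕP.m∸n≤m (suc k) y) ⟩
        d i (i -ℕ τ)                        ≡⟨ ≡.cong (d i) before ⟨
        d i (i -ℕ suc k +ℕ y)               ∎
        where
        τ = suc k ℕ.∸ y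
        before : i -ℕ suc k +ℕ y ≡ i -ℕ τ
        before = ≡.trans (shape i (+ suc k) (+ y))
                         (≡.cong (λ x → i ℤ.- x) (≡.sym (+-∸ (ℕP.m≤n⇒m≤1+n y≤k))))
        1≤τ : 1 ℕ.≤ τ
        1≤τ = ≡.subst (1 ℕ.≤_) (≡.sym (ℕP.+-∸-assoc 1 y≤k)) (s≤s z≤n)

    galeCoeffs-periodic : Periodic F w n α
    galeCoeffs-periodic i j 1≤j j≤w = begin
      α (i +ℕ n) j                          ≡⟨ ≡.cong₂ d (shape₁ i (+ n)) shifted ⟩
      d (I +ℕ n) (I -ℕ suc k +ℕ y +ℕ n)     ≈⟨ d-periodic I y ⟩
      d I (I -ℕ suc k +ℕ y)                 ≡⟨ ≡.cong (d I) unshifted ⟨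
      α i j                                 ∎
      where
      I = i +ℕ 1
      D = w ℕ.∸ j
      y = suc k ℕ.+ D
      w≡D+j : + w ≡ + D ℤ.+ + j
      w≡D+j = ≡.cong +_ (≡.sym (ℕP.m∸n+n≡m j≤w))
      shape₁ : ∀ i n → i ℤ.+ n ℤ.+ 1ℤ ≡ i ℤ.+ 1ℤ ℤ.+ n
      shape₁ = solve-∀
      shape₂ : ∀ i n k D j →
        D ℤ.+ j ℤ.+ (i ℤ.+ n) ℤ.- j ℤ.+ 1ℤ ≡ i ℤ.+ 1ℤ ℤ.- (1ℤ ℤ.+ k) ℤ.+ (1ℤ ℤ.+ k ℤ.+ D) ℤ.+ n
      shape₂ = solve-∀
      shape₃ : ∀ i k D j →
        D ℤ.+ j ℤ.+ i ℤ.- j ℤ.+ 1ℤ ≡ i ℤ.+ 1ℤ ℤ.- (1ℤ ℤ.+ k) ℤ.+ (1ℤ ℤ.+ k ℤ.+ D)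
      shape₃ = solve-∀
      shifted : + w ℤ.+ (i +ℕ n) ℤ.- + j ℤ.+ 1ℤ ≡ I -ℕ suc k +ℕ y +ℕ n
      shifted = ≡.trans (≡.cong (λ x → x ℤ.+ (i +ℕ n) ℤ.- + j ℤ.+ 1ℤ) w≡D+j)
                        (shape₂ i (+ n) (+ k) (+ D) (+ j))
      unshifted : + w ℤ.+ i ℤ.- + j ℤ.+ 1ℤ ≡ I -ℕ suc k +ℕ y
      unshifted = ≡.trans (≡.cong (λ x → x ℤ.+ i ℤ.- + j ℤ.+ 1ℤ) w≡D+j) (shape₃ i (+ k) (+ D) (+ j))

    coefficientRow : ℤ → ℕ → Carrier
    coefficientRow i zero    = 1#
    coefficientRow i (suc r) with ℕP.<-cmp r k
    ... | tri< _ _ _ = a i (suc r)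
    ... | tri≈ _ _ _ = 1#
    ... | tri> _ _ _ = 0#

    coefficientRow-coeff : ∀ i r → 1 ℕ.≤ r → r ℕ.≤ k → coefficientRow i r ≈ a i r
    coefficientRow-coeff i (suc r) _ r<k with ℕP.<-cmp r k
    ... | tri< _ _ _   = refl
    ... | tri≈ r≮k _ _ = contradiction r<k r≮k
    ... | tri> r≮k _ _ = contradiction r<k r≮k

    coefficientRow-last : ∀ i → coefficientRow i (suc k) ≈ 1#
    coefficientRow-last i with ℕP.<-cmp k k
    ... | tri< _ k≢k _ = contradiction ≡.refl k≢k
    ... | tri≈ _ _ _   = refl
    ... | tri> _ k≢k _ = contradiction ≡.refl k≢k

    coefficientRow-beyond : ∀ i r → suc (suc k) ℕ.≤ r → coefficientRow i r ≈ 0#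
    coefficientRow-beyond i (suc r) (s≤s k<r) with ℕP.<-cmp r k
    ... | tri< _ _ r≯k = contradiction k<r r≯k
    ... | tri≈ _ _ r≯k = contradiction k<r r≯k
    ... | tri> _ _ _   = refl

    base : ℤ → ℤ
    base t = t -ℕ (n ℕ.+ n')

    reversedRow : ℤ → ℕ → Carrier
    reversedRow t r = coefficientRow (t -ℕ suc k) (n' ℕ.∸ r)

    -- R_t; through ∣_∣ it is only meaningful from base t on, and only used there.
    dualSolution : ℤ → ℤ → Carrier
    dualSolution t u = sgn F w * antiperiodicExtension w n (reversedRow t) ∣ u ℤ.- base t ∣

    dualSolution-base : ∀ t y →
      dualSolution t (base t +ℕ y) ≡ sgn F w * antiperiodicExtension w n (reversedRow t) y
    dualSolution-base t y =
      ≡.cong (λ x → sgn F w * antiperiodicExtension w n (reversedRow t) ∣ x ∣) (shape (base t) (+ y))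
      where
      shape : ∀ b y → b ℤ.+ y ℤ.- b ≡ y
      shape = solve-∀

    dualSolution-window : ∀ t y → y ℕ.< n → dualSolution t (base t +ℕ y) ≈ sgn F w * reversedRow t y
    dualSolution-window t y y<n =
      trans (reflexive (dualSolution-base t y)) (*-congˡ (antiperiodicExtension-< w n (reversedRow t) y<n))

    dualSolution-antiperiodic : ∀ t y →
      dualSolution t (base t +ℕ y +ℕ n) ≈ sgn F w * dualSolution t (base t +ℕ y)
    dualSolution-antiperiodic t y = begin
      dualSolution t (base t +ℕ y +ℕ n)                       ≡⟨ ≡.cong (dualSolution t) (+ℕ-+ (base t) y n) ⟨
      dualSolution t (base t +ℕ (y ℕ.+ n))                    ≡⟨ dualSolution-base t (y ℕ.+ n) ⟩
      sgn F w * extension (y ℕ.+ n)                           ≈⟨ *-congˡ (antiperiodicExtension-+ w n (reversedRow t) y) ⟩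
      sgn F w * (sgn F w * extension y)                       ≡⟨ ≡.cong (sgn F w *_) (dualSolution-base t y) ⟨
      sgn F w * dualSolution t (base t +ℕ y)                  ∎
      where extension = antiperiodicExtension w n (reversedRow t)

    dualSolution-row : ∀ t r → r ℕ.≤ n' → dualSolution t (t -ℕ r) ≈ coefficientRow (t -ℕ suc k) r
    dualSolution-row t r r≤n' = begin
      dualSolution t (t -ℕ r)                             ≡⟨ ≡.cong (dualSolution t) position ⟩
      dualSolution t (base t +ℕ D +ℕ n)                   ≈⟨ dualSolution-antiperiodic t D ⟩
      sgn F w * dualSolution t (base t +ℕ D)              ≈⟨ *-congˡ (dualSolution-window t D D<n) ⟩
      sgn F w * (sgn F w * reversedRow t D)               ≈⟨ sgn-cancelˡ w _ ⟩
      coefficientRow (t -ℕ suc k) (n' ℕ.∸ D)              ≡⟨ ≡.cong (coefficientRow _) (ℕP.m∸[m∸n]≡n r≤n') ⟩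
      coefficientRow (t -ℕ suc k) r                       ∎
      where
      D = n' ℕ.∸ r
      D<n = s≤s (ℕP.m∸n≤m n' r)
      shape : ∀ t r n' → t ℤ.- r ≡ t ℤ.- (1ℤ ℤ.+ n' ℤ.+ n') ℤ.+ (n' ℤ.- r) ℤ.+ (1ℤ ℤ.+ n')
      shape = solve-∀
      position : t -ℕ r ≡ base t +ℕ D +ℕ n
      position = ≡.trans (shape t (+ r) (+ n')) (≡.cong (λ x → base t ℤ.+ x ℤ.+ + n) (≡.sym (+-∸ r≤n')))

    dualSolution-after : ∀ t s → 1 ℕ.≤ s → s ℕ.≤ w → dualSolution t (t +ℕ s) ≈ 0#
    dualSolution-after t (suc s) _ s<w = begin
      dualSolution t (t +ℕ suc s)                         ≡⟨ ≡.cong (dualSolution t) (shape t (+ s) (+ n')) ⟩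
      dualSolution t (base t +ℕ (s ℕ.+ n) +ℕ n)           ≈⟨ dualSolution-antiperiodic t (s ℕ.+ n) ⟩
      sgn F w * dualSolution t (base t +ℕ (s ℕ.+ n))      ≡⟨ ≡.cong ((sgn F w *_) ∘ dualSolution t) (+ℕ-+ (base t) s n) ⟩
      sgn F w * dualSolution t (base t +ℕ s +ℕ n)         ≈⟨ *-congˡ (dualSolution-antiperiodic t s) ⟩
      sgn F w * (sgn F w * dualSolution t (base t +ℕ s))  ≈⟨ sgn-cancelˡ w _ ⟩
      dualSolution t (base t +ℕ s)                        ≈⟨ dualSolution-window t s s<n ⟩
      sgn F w * reversedRow t s                           ≈⟨ *-congˡ (coefficientRow-beyond _ _ beyond) ⟩
      sgn F w * 0#                                        ≈⟨ zeroʳ _ ⟩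
      0#                                                  ∎
      where
      shape : ∀ t s n' →
        t ℤ.+ (1ℤ ℤ.+ s) ≡ t ℤ.- (1ℤ ℤ.+ n' ℤ.+ n') ℤ.+ (s ℤ.+ (1ℤ ℤ.+ n')) ℤ.+ (1ℤ ℤ.+ n')
      shape = solve-∀
      s<n : s ℕ.< n
      s<n = s≤s (ℕP.m≤n⇒m≤1+n (ℕP.≤-trans (ℕP.<⇒≤ s<w) (ℕP.m≤n+m w k)))
      beyond : suc (suc k) ℕ.≤ n' ℕ.∸ s
      beyond = ≡.subst (ℕ._≤ n' ℕ.∸ s) (ℕP.m+n∸n≡m (suc (suc k)) s)
        (ℕP.∸-monoˡ-≤ s (≡.subst (ℕ._≤ n') (≡.cong suc (ℕP.+-suc k s)) (s≤s (ℕP.+-monoʳ-≤ k s<w))))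

    pairing : ℤ → ℤ → ℤ → Carrier
    pairing t i u = d (i +ℕ 1) (u +ℕ suc w) * dualSolution t u

    pairing-antiperiodic : ∀ t i y →
      pairing t i (base t +ℕ y +ℕ n) ≈ sgn F n * pairing t i (base t +ℕ y)
    pairing-antiperiodic t i y = begin
      d I (u +ℕ n +ℕ suc w) * dualSolution t (u +ℕ n)            ≈⟨ *-cong frieze (dualSolution-antiperiodic t y) ⟩
      sgn F k * d I (u +ℕ suc w) * (sgn F w * dualSolution t u)   ≈⟨ interchange _ _ _ _ ⟩
      sgn F k * sgn F w * pairing t i u                           ≈⟨ *-congʳ signs ⟩
      sgn F n * pairing t i u                                     ∎
      where
      I = i +ℕ 1
      u = base t +ℕ y
      shape : ∀ u m l → u ℤ.+ m ℤ.+ l ≡ u ℤ.+ l ℤ.+ m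
      shape = solve-∀
      frieze : d I (u +ℕ n +ℕ suc w) ≈ sgn F k * d I (u +ℕ suc w)
      frieze = trans (reflexive (≡.cong (d I) (shape u (+ n) (+ suc w)))) (d-antiperiodic I _)
      interchange : ∀ p q x y → p * x * (q * y) ≈ p * q * (x * y)
      interchange = Solver.solve 4 (λ p q x y → (((p ⊗ x) ⊗ (q ⊗ y)) ⊜ ((p ⊗ q) ⊗ (x ⊗ y)))) refl
      signs : sgn F k * sgn F w ≈ sgn F n
      signs = trans (sym (sgn-+ k w)) (sym (-‿involutive _))

    windowSum-pairing-self : ∀ t i → windowSum n (pairing t i) t ≈ 0#
    windowSum-pairing-self t i = begin
      windowSum n (pairing t i) t                                    ≈⟨ ∑-cong n termwise ⟩
      ∑ n f                                                          ≈⟨ ∑-+ (suc (suc k)) w f ⟩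
      ∑ (suc (suc k)) f + ∑[ y < w ] f (suc (suc k) ℕ.+ y)          ≈⟨ +-cong recurrence (∑-≈0 w (λ y _ → beyond y)) ⟩
      0# + 0#                                                        ≈⟨ +-identityʳ 0# ⟩
      0#                                                             ∎
      where
      X = d (i +ℕ 1)
      t₀ = t -ℕ suc k
      s = t +ℕ suc w
      f = λ y → sgn F y * (coefficientRow t₀ y * X (s -ℕ y))
      termwise : ∀ y → y ℕ.< n → sgn F y * pairing t i (t -ℕ y) ≈ f y
      termwise y y<n = *-congˡ (trans
        (*-cong (reflexive (≡.cong X (≡.sym (+ℕ--ℕ-comm t (suc w) y)))) (dualSolution-row t y (ℕP.≤-pred y<n)))
        (*-comm _ _))
      shape : ∀ t k w → t ℤ.+ (1ℤ ℤ.+ w) ≡ t ℤ.- (1ℤ ℤ.+ k) ℤ.+ (1ℤ ℤ.+ (1ℤ ℤ.+ (k ℤ.+ w)))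
      shape = solve-∀
      row≈a : ∀ y → 1 ℕ.≤ y → y ℕ.≤ k → coefficientRow t₀ y ≈ a s y
      row≈a y 1≤y y≤k = trans (coefficientRow-coeff t₀ y 1≤y y≤k)
        (sym (trans (reflexive (≡.cong (λ x → a x y) (shape t (+ k) (+ w)))) (proj₁ a∈E t₀ y 1≤y y≤k)))
      recurrence : ∑ (suc (suc k)) f ≈ 0#
      recurrence = Equivalence.to
        (SolutionAt⇔alternatingSum≈0 k a X s (coefficientRow t₀) refl (coefficientRow-last t₀) row≈a)
        (d-solution (i +ℕ 1) s)
      beyond : ∀ y → f (suc (suc k) ℕ.+ y) ≈ 0#
      beyond y = trans (*-congˡ (trans (*-congʳ row≈0) (zeroˡ _))) (zeroʳ _)
        where row≈0 = coefficientRow-beyond t₀ _ (ℕP.m≤m+n (suc (suc k)) y)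

    windowSum-pairing⇒SolutionAt : ∀ t i → windowSum n (pairing t i) i ≈ 0# →
                                   SolutionAt w α (dualSolution t) i
    windowSum-pairing⇒SolutionAt t i orthogonal = Equivalence.from
      (SolutionAt⇔alternatingSum≈0 w α (dualSolution t) i coeff coeff₀≈1 coeffₗ≈1 coeff≈α) (begin
        ∑ (suc (suc w)) f                                       ≈⟨ +-identityʳ _ ⟨
        ∑ (suc (suc w)) f + 0#                                   ≈⟨ +-congˡ (∑-≈0 k (λ y y<k → vanishing y y<k)) ⟨
        ∑ (suc (suc w)) f + ∑[ y < k ] f (suc (suc w) ℕ.+ y)    ≈⟨ ∑-+ (suc (suc w)) k f ⟨
        ∑ (suc (suc w) ℕ.+ k) f                                 ≡⟨ ≡.cong (λ N → ∑ (suc (suc N)) f) (ℕP.+-comm w k) ⟩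
        windowSum n (pairing t i) i                             ≈⟨ orthogonal ⟩
        0#                                                      ∎)
      where
      I = i +ℕ 1
      coeff = λ y → d I (i -ℕ y +ℕ suc w)
      f = λ y → sgn F y * (coeff y * dualSolution t (i -ℕ y))
      shape₀ : ∀ i w → i ℤ.- ℤ.0ℤ ℤ.+ (1ℤ ℤ.+ w) ≡ i ℤ.+ 1ℤ ℤ.+ w
      shape₀ = solve-∀
      shapeₗ : ∀ i w → i ℤ.- (1ℤ ℤ.+ w) ℤ.+ (1ℤ ℤ.+ w) ≡ i ℤ.+ 1ℤ ℤ.- 1ℤ
      shapeₗ = solve-∀
      shapeα : ∀ i w y → i ℤ.- y ℤ.+ (1ℤ ℤ.+ w) ≡ w ℤ.+ i ℤ.- y ℤ.+ 1ℤ
      shapeα = solve-∀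
      shapeₜ : ∀ i w y →
        i ℤ.- (1ℤ ℤ.+ (1ℤ ℤ.+ w) ℤ.+ y) ℤ.+ (1ℤ ℤ.+ w) ≡ i ℤ.+ 1ℤ ℤ.- (1ℤ ℤ.+ (1ℤ ℤ.+ y))
      shapeₜ = solve-∀
      coeff₀≈1 : coeff 0 ≈ 1#
      coeff₀≈1 = trans (reflexive (≡.cong (d I) (shape₀ i (+ w)))) (d-diagonal I)
      coeffₗ≈1 : coeff (suc w) ≈ 1#
      coeffₗ≈1 = trans (reflexive (≡.cong (d I) (shapeₗ i (+ w)))) (d-initial-one I)
      coeff≈α : ∀ y → 1 ℕ.≤ y → y ℕ.≤ w → coeff y ≈ α i y
      coeff≈α y _ _ = reflexive (≡.cong (d I) (shapeα i (+ w) (+ y)))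
      vanishing : ∀ y → y ℕ.< k → f (suc (suc w) ℕ.+ y) ≈ 0#
      vanishing y y<k = trans (*-congˡ (trans (*-congʳ initial) (zeroˡ _))) (zeroʳ _)
        where
        initial : coeff (suc (suc w) ℕ.+ y) ≈ 0#
        initial = trans (reflexive (≡.cong (d I) (shapeₜ i (+ w) (+ y))))
                        (d-initial-zero I (suc (suc y)) (s≤s (s≤s z≤n)) (s≤s y<k))

    windowSum-pairing-vanishes : ∀ t i y → windowSum n (pairing t i) (t -ℕ n +ℕ y) ≈ 0#
    windowSum-pairing-vanishes t i = alternating-≈0 S flip n atSelf
      where
      W = windowSum n (pairing t i)
      S = λ y → W (t -ℕ n +ℕ y)
      shape₁ : ∀ t y n' →
        t ℤ.- (1ℤ ℤ.+ n' ℤ.+ n') ℤ.+ y ℤ.+ (1ℤ ℤ.+ n') ≡ t ℤ.- (1ℤ ℤ.+ n') ℤ.+ (1ℤ ℤ.+ y)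
      shape₁ = solve-∀
      shape₂ : ∀ t y n' → t ℤ.- (1ℤ ℤ.+ n' ℤ.+ n') ℤ.+ y ℤ.+ n' ≡ t ℤ.- (1ℤ ℤ.+ n') ℤ.+ y
      shape₂ = solve-∀
      flip : ∀ y → S (suc y) ≈ - S y
      flip y = begin
        S (suc y)                   ≡⟨ ≡.cong W (shape₁ t (+ y) (+ n')) ⟨
        W (base t +ℕ y +ℕ n)        ≈⟨ windowSum-step n' (pairing t i) (base t +ℕ y) (pairing-antiperiodic t i y) ⟩
        - W (base t +ℕ y +ℕ n')     ≡⟨ ≡.cong (-_ ∘ W) (shape₂ t (+ y) (+ n')) ⟩
        - S y                       ∎
      atSelf : S n ≈ 0#
      atSelf = trans (reflexive (≡.cong W (-ℕ-cancel+ℕ t n))) (windowSum-pairing-self t i)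

    dualSolution-isSolutionFrom : ∀ t → IsSolutionFrom w α (dualSolution t) (t -ℕ n)
    dualSolution-isSolutionFrom t y =
      windowSum-pairing⇒SolutionAt t _ (windowSum-pairing-vanishes t (t -ℕ n +ℕ y) y)

    AntiperiodicFrom : ℤ → (ℤ → Carrier) → Set ℓ
    AntiperiodicFrom p W = ∀ y → W (p +ℕ y +ℕ n) ≈ sgn F w * W (p +ℕ y)

    AntiperiodicFrom-+ : ∀ p m W → AntiperiodicFrom p W → AntiperiodicFrom (p +ℕ m) W
    AntiperiodicFrom-+ p m W anti y = ≡.subst (λ u → W (u +ℕ n) ≈ sgn F w * W u) (+ℕ-+ p m y) (anti (m ℕ.+ y))

    AntiperiodicFrom-linear : ∀ p V U q → AntiperiodicFrom p V → AntiperiodicFrom p U →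
                              AntiperiodicFrom p (λ u → V u + q * U u)
    AntiperiodicFrom-linear p V U q antiV antiU y =
      trans (+-cong (antiV y) (*-congˡ (antiU y))) (regroup (sgn F w) _ q _)
      where
      regroup : ∀ s v q u → s * v + q * (s * u) ≈ s * (v + q * u)
      regroup = Solver.solve 4 (λ s v q u → (((s ⊗ v) ⊕ (q ⊗ (s ⊗ u))) ⊜ (s ⊗ (v ⊕ (q ⊗ u))))) refl

    AntiperiodicFrom-cong : ∀ p {V U} → (∀ u → V u ≈ U u) → AntiperiodicFrom p V → AntiperiodicFrom p U
    AntiperiodicFrom-cong p V≈U anti y = trans (sym (V≈U _)) (trans (anti y) (*-congˡ (V≈U _)))

    dualSolution-self : ∀ t → dualSolution t t ≈ 1#
    dualSolution-self t = trans (reflexive (≡.cong (dualSolution t) (≡.sym (ℤP.+-identityʳ t))))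
                                (dualSolution-row t 0 z≤n)

    dualSolution-isSolutionFrom-+ : ∀ p m → m ℕ.≤ n → IsSolutionFrom w α (dualSolution (p +ℕ m)) (p +ℕ suc w)
    dualSolution-isSolutionFrom-+ p m m≤n N =
      ≡.subst (SolutionAt w α (dualSolution t)) position (dualSolution-isSolutionFrom t L)
      where
      t = p +ℕ m
      L = (n ℕ.+ (suc w ℕ.+ N)) ℕ.∸ m
      shape : ∀ p m n a b → p ℤ.+ m ℤ.- n ℤ.+ (n ℤ.+ (a ℤ.+ b) ℤ.- m) ≡ p ℤ.+ a ℤ.+ b
      shape = solve-∀
      position : t -ℕ n +ℕ L ≡ p +ℕ suc w +ℕ N
      position = ≡.trans (≡.cong (λ x → t -ℕ n ℤ.+ x) (+-∸ (ℕP.≤-trans m≤n (ℕP.m≤m+n n _))))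
                         (shape p (+ m) (+ n) (+ suc w) (+ N))

    dualSolution-antiperiodicFrom-+ : ∀ p m → m ℕ.≤ n → AntiperiodicFrom p (dualSolution (p +ℕ m))
    dualSolution-antiperiodicFrom-+ p m m≤n =
      ≡.subst (λ x → AntiperiodicFrom x R) (≡.sym position) (AntiperiodicFrom-+ (base t) _ R (dualSolution-antiperiodic t))
      where
      t = p +ℕ m
      R = dualSolution t
      shape : ∀ p m l → p ≡ p ℤ.+ m ℤ.- l ℤ.+ (l ℤ.- m)
      shape = solve-∀
      position : p ≡ base t +ℕ ((n ℕ.+ n') ℕ.∸ m)
      position = ≡.trans (shape p (+ m) (+ (n ℕ.+ n')))
                         (≡.cong (λ x → base t ℤ.+ x) (≡.sym (+-∸ (ℕP.≤-trans m≤n (ℕP.m≤m+n n n')))))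

    -- Subtracting W(t)·R_t with t = p + m extends the vanishing range down to m.
    IsSolutionFrom⇒AntiperiodicFrom : ∀ m → m ℕ.≤ suc w → ∀ p W → IsSolutionFrom w α W (p +ℕ suc w) →
      (∀ s → m ℕ.≤ s → s ℕ.≤ w → W (p +ℕ s) ≈ 0#) → AntiperiodicFrom p W
    IsSolutionFrom⇒AntiperiodicFrom zero _ p W sol vanish y = begin
      W (p +ℕ y +ℕ n)         ≡⟨ ≡.cong W (+ℕ-+ p y n) ⟨
      W (p +ℕ (y ℕ.+ n))      ≈⟨ W≈0 (y ℕ.+ n) ⟩
      0#                      ≈⟨ zeroʳ _ ⟨
      sgn F w * 0#            ≈⟨ *-congˡ (W≈0 y) ⟨
      sgn F w * W (p +ℕ y)    ∎
      where W≈0 = IsSolutionFrom-vanish w α W p sol (λ s → vanish s z≤n)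
    IsSolutionFrom⇒AntiperiodicFrom (suc m) m<1+w p W sol vanish =
      AntiperiodicFrom-cong p undo (AntiperiodicFrom-linear p W′ R (- q) W′-antiperiodic
                                                           (dualSolution-antiperiodicFrom-+ p m m≤n))
      where
      m≤w = ℕP.≤-pred m<1+w
      m≤n = ℕP.≤-trans m≤w (ℕP.≤-trans (ℕP.m≤n+m w k) (ℕP.m≤n+m _ 2))
      t = p +ℕ m
      R = dualSolution t
      q = - W t
      W′ = λ u → W u + q * R u
      W′-vanish : ∀ s → m ℕ.≤ s → s ℕ.≤ w → W′ (p +ℕ s) ≈ 0#
      W′-vanish s m≤s s≤w with ℕP.m≤n⇒m<n∨m≡n m≤s
      ... | inj₂ ≡.refl = begin
        W t + q * R t               ≈⟨ +-congˡ (*-congˡ (dualSolution-self t)) ⟩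
        W t + q * 1#                ≈⟨ +-congˡ (*-identityʳ q) ⟩
        W t + - W t                 ≈⟨ -‿inverseʳ _ ⟩
        0#                          ∎
      ... | inj₁ m<s = begin
        W (p +ℕ s) + q * R (p +ℕ s)     ≈⟨ +-cong (vanish s m<s s≤w) (*-congˡ R≈0) ⟩
        0# + q * 0#                     ≈⟨ +-identityˡ _ ⟩
        q * 0#                          ≈⟨ zeroʳ q ⟩
        0#                              ∎
        where
        position : p +ℕ s ≡ t +ℕ (s ℕ.∸ m)
        position = ≡.trans (≡.cong (p +ℕ_) (≡.sym (ℕP.m+[n∸m]≡n m≤s))) (+ℕ-+ p m (s ℕ.∸ m))
        R≈0 : R (p +ℕ s) ≈ 0#
        R≈0 = trans (reflexive (≡.cong R position))
                    (dualSolution-after t (s ℕ.∸ m) (ℕP.m<n⇒0<n∸m m<s) (ℕP.≤-trans (ℕP.m∸n≤m s m) s≤w))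
      W′-antiperiodic : AntiperiodicFrom p W′
      W′-antiperiodic = IsSolutionFrom⇒AntiperiodicFrom m (ℕP.m≤n⇒m≤1+n m≤w) p W′
        (λ N → SolutionAt-linear w α W R q _ (sol N) (dualSolution-isSolutionFrom-+ p m m≤n N)) W′-vanish
      undo : ∀ u → W′ u + (- q) * R u ≈ W u
      undo u = begin
        W u + q * R u + (- q) * R u     ≈⟨ +-assoc _ _ _ ⟩
        W u + (q * R u + (- q) * R u)   ≈⟨ +-congˡ (distribʳ (R u) q (- q)) ⟨
        W u + (q + - q) * R u           ≈⟨ +-congˡ (trans (*-congʳ (-‿inverseʳ q)) (zeroˡ _)) ⟩
        W u + 0#                        ≈⟨ +-identityʳ _ ⟩
        W u                             ∎

    galeSolution-antiperiodic : ∀ W → IsSolution F w α W → ∀ i → W (i +ℕ n) ≈ sgn F w * W i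
    galeSolution-antiperiodic W sol i = ≡.subst (λ j → W (j +ℕ n) ≈ sgn F w * W j) (ℤP.+-identityʳ i)
      (IsSolutionFrom⇒AntiperiodicFrom (suc w) ℕP.≤-refl i W (λ _ → sol _)
        (λ s w<s s≤w → contradiction (ℕP.≤-trans w<s s≤w) ℕP.1+n≰n) 0)

    galeCoeffs-InE : InE F w n α
    galeCoeffs-InE = galeCoeffs-periodic , galeSolution-antiperiodic

    dualFrieze-row : ∀ e → IsFrieze F w α e → ∀ i y →
      e (i +ℕ 1) (i -ℕ w +ℕ y) ≈ dualSolution (i +ℕ suc k) (i -ℕ w +ℕ y)
    dualFrieze-row e e-frieze i = IsSolutionFrom-agree w α E R P E-solution R-solution initial
      where
      E = e (i +ℕ 1)
      t = i +ℕ suc k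
      R = dualSolution t
      P = i -ℕ w
      E-solution : IsSolutionFrom w α E (P +ℕ suc w)
      E-solution _ = proj₁ (e-frieze (i +ℕ 1)) _
      shape : ∀ i k w N → i ℤ.+ (1ℤ ℤ.+ k) ℤ.- (1ℤ ℤ.+ (1ℤ ℤ.+ (k ℤ.+ w))) ℤ.+ (1ℤ ℤ.+ (1ℤ ℤ.+ w) ℤ.+ N)
                        ≡ i ℤ.- w ℤ.+ (1ℤ ℤ.+ w) ℤ.+ N
      shape = solve-∀
      R-solution : IsSolutionFrom w α R (P +ℕ suc w)
      R-solution N = ≡.subst (SolutionAt w α R) (shape i (+ k) (+ w) (+ N))
                             (dualSolution-isSolutionFrom t (suc (suc w) ℕ.+ N))
      initialValue : ∀ D → D ℕ.≤ w → E (i +ℕ 1 -ℕ suc D) ≈ R (t -ℕ (suc k ℕ.+ D))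
      initialValue zero    _   = begin
        E (i +ℕ 1 -ℕ 1)                       ≈⟨ proj₂ (proj₂ (e-frieze (i +ℕ 1))) ⟩
        1#                                    ≈⟨ coefficientRow-last (t -ℕ suc k) ⟨
        coefficientRow (t -ℕ suc k) (suc k)   ≈⟨ dualSolution-row t (suc k) (s≤s (ℕP.m≤m+n k w)) ⟨
        R (t -ℕ suc k)                        ≡⟨ ≡.cong (λ r → R (t -ℕ r)) (ℕP.+-identityʳ (suc k)) ⟨
        R (t -ℕ (suc k ℕ.+ 0))                ∎
      initialValue (suc D) D<w = begin
        E (i +ℕ 1 -ℕ suc (suc D))                       ≈⟨ proj₁ (proj₂ (e-frieze (i +ℕ 1))) _ (s≤s (s≤s z≤n)) (s≤s D<w) ⟩
        0#                                              ≈⟨ coefficientRow-beyond (t -ℕ suc k) _ beyond ⟨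
        coefficientRow (t -ℕ suc k) (suc k ℕ.+ suc D)   ≈⟨ dualSolution-row t _ (s≤s (ℕP.+-monoʳ-≤ k D<w)) ⟨
        R (t -ℕ (suc k ℕ.+ suc D))                      ∎
        where
        beyond : suc (suc k) ℕ.≤ suc k ℕ.+ suc D
        beyond = s≤s (≡.subst (suc k ℕ.≤_) (≡.sym (ℕP.+-suc k D)) (s≤s (ℕP.m≤m+n k D)))
      initial : ∀ s → s ℕ.≤ w → E (P +ℕ s) ≈ R (P +ℕ s)
      initial s s≤w = begin
        E (P +ℕ s)                    ≡⟨ ≡.cong E (≡.trans P+s (shapeE i (+ s) (+ D))) ⟩
        E (i +ℕ 1 -ℕ suc D)           ≈⟨ initialValue D (ℕP.m∸n≤m w s) ⟩
        R (t -ℕ (suc k ℕ.+ D))        ≡⟨ ≡.cong R (≡.trans P+s (shapeR i (+ s) (+ D) (+ k))) ⟨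
        R (P +ℕ s)                    ∎
        where
        D = w ℕ.∸ s
        P+s : P +ℕ s ≡ i ℤ.- (+ s ℤ.+ + D) ℤ.+ + s
        P+s = ≡.cong (λ x → i ℤ.- x ℤ.+ + s) (≡.cong +_ (≡.sym (ℕP.m+[n∸m]≡n s≤w)))
        shapeE : ∀ i s D → i ℤ.- (s ℤ.+ D) ℤ.+ s ≡ i ℤ.+ 1ℤ ℤ.- (1ℤ ℤ.+ D)
        shapeE = solve-∀
        shapeR : ∀ i s D k → i ℤ.- (s ℤ.+ D) ℤ.+ s ≡ i ℤ.+ (1ℤ ℤ.+ k) ℤ.- (1ℤ ℤ.+ k ℤ.+ D)
        shapeR = solve-∀

    galeCoeffs-involutive : ∀ e → IsFrieze F w α e → ∀ i j → 1 ℕ.≤ j → j ℕ.≤ k →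
                            galeCoeffs F k e i j ≈ a i j
    galeCoeffs-involutive e e-frieze i j 1≤j j≤k = begin
      e (i +ℕ 1) (+ k ℤ.+ i ℤ.- + j ℤ.+ 1ℤ)    ≡⟨ ≡.cong (e (i +ℕ 1)) (≡.trans (shape₁ i (+ k) (+ j) (+ w)) (≡.sym P+Y)) ⟩
      e (i +ℕ 1) (i -ℕ w +ℕ Y)                 ≈⟨ dualFrieze-row e e-frieze i Y ⟩
      R (i -ℕ w +ℕ Y)                          ≡⟨ ≡.cong R (≡.trans P+Y (shape₂ i (+ k) (+ j) (+ w))) ⟩
      R (t -ℕ j)                               ≈⟨ dualSolution-row t j j≤n' ⟩
      coefficientRow (t -ℕ suc k) j            ≈⟨ coefficientRow-coeff (t -ℕ suc k) j 1≤j j≤k ⟩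
      a (t -ℕ suc k) j                         ≡⟨ ≡.cong (λ x → a x j) (+ℕ-cancel-ℕ i (suc k)) ⟩
      a i j                                    ∎
      where
      t = i +ℕ suc k
      R = dualSolution t
      Y = w ℕ.+ (suc k ℕ.∸ j)
      j≤n' = ℕP.≤-trans j≤k (ℕP.≤-trans (ℕP.m≤m+n k w) (ℕP.n≤1+n _))
      P+Y : i -ℕ w +ℕ Y ≡ i -ℕ w ℤ.+ (+ w ℤ.+ (+ suc k ℤ.- + j))
      P+Y = ≡.cong (λ x → i -ℕ w ℤ.+ (+ w ℤ.+ x)) (+-∸ (ℕP.m≤n⇒m≤1+n j≤k))
      shape₁ : ∀ i k j w → k ℤ.+ i ℤ.- j ℤ.+ 1ℤ ≡ i ℤ.- w ℤ.+ (w ℤ.+ (1ℤ ℤ.+ k ℤ.- j))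
      shape₁ = solve-∀
      shape₂ : ∀ i k j w → i ℤ.- w ℤ.+ (w ℤ.+ (1ℤ ℤ.+ k ℤ.- j)) ≡ i ℤ.+ (1ℤ ℤ.+ k) ℤ.- j
      shape₂ = solve-∀

open import Data.Nat using (_≤_; _+_; _∸_)

theorem4p2 : ∀ {c ℓ : Level} (F : Field c ℓ) (k n : ℕ) → 1 ≤ k → k + 2 ≤ n →
    (a : Coeffs F) → InE F k n a →
    (d : ℤ → ℤ → Field.Carrier F) → IsFrieze F k a d →
    InE F (n ∸ (k + 2)) n (galeCoeffs F (n ∸ (k + 2)) d)
    × (∀ (e : ℤ → ℤ → Field.Carrier F) →
         IsFrieze F (n ∸ (k + 2)) (galeCoeffs F (n ∸ (k + 2)) d) e →
         ∀ (i : ℤ) (j : ℕ) → 1 ≤ j → j ≤ k →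
         Field._≈_ F (galeCoeffs F k e i j) (a i j))
theorem4p2 F k n _ k+2≤n a a∈E d d-frieze =
  ≡.subst (λ m → InE F w m (galeCoeffs F w d)) (≡.sym period) galeCoeffs-InE , galeCoeffs-involutive
  where
  w = n ∸ (k + 2)
  period : n ≡ 2 + (k + w)
  period = ≡.trans (≡.sym (ℕP.m+[n∸m]≡n k+2≤n)) (≡.cong (_+ w) (ℕP.+-comm k 2))
  open Recurrences.GaleDuality F k w a (≡.subst (λ m → InE F k m a) period a∈E) d d-frieze
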